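{- Let $r \ge 4$ and let $G$ be a $K_r$-partite-saturated $r$-partite graph with parts $V_1,\dots,V_r$, containing an independent set $X = \{x_1,\dots,x_r\}$ with $x_i \in V_i$ for all $i$. Then: (i) A special vertex $y_i \in V_i$ is adjacent to every vertex of $X$ except $x_i$. (ii) Each $V_i$ contains at most one special vertex. (iii) If $y_i \in V_i$ is $i'$-special and $y_j \in V_j$ is $j'$-special with $i' \ne j$ and $j' \ne i$, then $y_iy_j$ is an edge. (iv) The number of vertices of special degree at least $2$ is at most $r-2$. (v) If $y_i \in V_i$ is $i'$-special and $y_j \in V_j$ with $j \ne i, i'$, then $y_j$ is adjacent to $y_i$ or to $x_{i'}$. (vi) For a special vertex $y_i \in V_i$, there exist indices $j, l$ with $i,j,l$ distinct such that $N(x_i) \cap V_j$ and $N(x_i) \cap V_l$ each contain a non-neighbour of $y_i$.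
   Context: All graphs are finite and simple. An $r$-partite graph comes with a fixed partition of its vertex set into $r$ parts. An admissible non-edge is a non-adjacent pair of vertices in different parts. A $k$-partite graph is $K_r$-partite-saturated if it contains no $K_r$ but adding any admissible non-edge creates a copy of $K_r$. With $G$ and $X$ as in the claim and $X^c = V(G)\setminus X$: a vertex $y \in X^c$ is $i$-special if $y$ is the only neighbour of $x_i$ in the part of $G$ containing $y$; the special degree of $y \in X^c$ is the number of $i \in [r]$ such that $y$ is $i$-special; $y$ is special if its special degree is at least one. -}

module Defs where

open import Data.Nat using (ℕ; _≤_; _≤?_)
open import Data.Fin using (Fin; _≟_)
open import Data.Fin.Properties using (all?)
open import Data.Bool using (Bool; true; false; _∨_; _∧_)
open import Data.List using (List; length; filter; allFin)
open import Data.Product using (_×_; Σ; _,_)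
open import Relation.Binary.PropositionalEquality using (_≡_; _≢_)
open import Relation.Nullary using (Dec; ¬_; ¬?; does)
open import Relation.Nullary.Decidable using (_×-dec_; _→-dec_)
open import Data.Bool.Properties using () renaming (_≟_ to _≟ᵇ_)

-- A finite simple r-partite graph on the vertex set Fin n, with a fixed
-- partition  part : Fin n → Fin r  (vertex v lies in part V_(part v)).
record PartiteGraph (n r : ℕ) : Set where
  field
    adj      : Fin n → Fin n → Bool
    part     : Fin n → Fin r
    sym      : ∀ u v → adj u v ≡ adj v u
    irrefl   : ∀ v → adj v v ≡ false
    partite  : ∀ u v → adj u v ≡ true → part u ≢ part v
open PartiteGraph public

addEdge : ∀ {n} → (Fin n → Fin n → Bool) → Fin n → Fin n → Fin n → Fin n → Bool
addEdge adj a b u v =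
  adj u v ∨ ((does (u ≟ a) ∧ does (v ≟ b)) ∨ (does (u ≟ b) ∧ does (v ≟ a)))

HasKr : ∀ {n} (r : ℕ) → (Fin n → Fin n → Bool) → Set
HasKr {n} r A = Σ (Fin r → Fin n) λ f →
  (∀ i j → i ≢ j → f i ≢ f j) × (∀ i j → i ≢ j → A (f i) (f j) ≡ true)

AdmissibleNonEdge : ∀ {n r} → PartiteGraph n r → Fin n → Fin n → Set
AdmissibleNonEdge G u v = (part G u ≢ part G v) × (adj G u v ≡ false)

KrPartiteSaturated : ∀ {n k} (r : ℕ) → PartiteGraph n k → Set
KrPartiteSaturated r G =
  ¬ HasKr r (adj G) ×
  (∀ u v → AdmissibleNonEdge G u v → HasKr r (addEdge (adj G) u v))

IndependentTransversal : ∀ {n r} → PartiteGraph n r → (Fin r → Fin n) → Set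
IndependentTransversal {r = r} G x =
  (∀ i → part G (x i) ≡ i) × (∀ i j → adj G (x i) (x j) ≡ false)

InXc : ∀ {n r} → (Fin r → Fin n) → Fin n → Set
InXc x y = ∀ j → y ≢ x j

IsSpecialFor : ∀ {n r} → PartiteGraph n r → (Fin r → Fin n) → Fin r → Fin n → Set
IsSpecialFor G x i y =
  InXc x y × (adj G (x i) y ≡ true) ×
  (∀ z → part G z ≡ part G y → adj G (x i) z ≡ true → z ≡ y)

isSpecialFor? : ∀ {n r} (G : PartiteGraph n r) x i y → Dec (IsSpecialFor G x i y)
isSpecialFor? G x i y =
  all? (λ j → ¬? (y ≟ x j)) ×-dec
  (adj G (x i) y ≟ᵇ true) ×-dec
  all? (λ z → (part G z ≟ part G y) →-dec ((adj G (x i) z ≟ᵇ true) →-dec (z ≟ y)))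

specialDegree : ∀ {n r} → PartiteGraph n r → (Fin r → Fin n) → Fin n → ℕ
specialDegree {r = r} G x y = length (filter (λ i → isSpecialFor? G x i y) (allFin r))

IsSpecial : ∀ {n r} → PartiteGraph n r → (Fin r → Fin n) → Fin n → Set
IsSpecial G x y = Σ _ λ i → IsSpecialFor G x i y

numSpecialDeg≥2 : ∀ {n r} → PartiteGraph n r → (Fin r → Fin n) → ℕ
numSpecialDeg≥2 {n} G x = length (filter (λ y → 2 ≤? specialDegree G x y) (allFin n))

module Submission where

-- Everything rests on one consequence of saturation.  For an admissible non-edge
-- uv with u ∈ V_a and v ∈ V_b, adding uv creates a K_r; since edges of G + uv join
-- distinct parts, this K_r is a transversal, and since G itself is K_r-free it
-- uses the edge uv.  So there are vertices C_k ∈ V_k (k ∈ [r]) with C_a = u,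
-- C_b = v, all other pairs adjacent in G (a "saturating clique").  Applied to
-- the non-edges x_p x_q, and combined with the observation that a p-special
-- vertex y must be the clique vertex of its part whenever C_p = x_p (it is the
-- unique neighbour of x_p there), this yields (i), (ii), (iii), (v) directly.
-- For (vi), if y were adjacent to all of C outside {x_i, x_m}, then replacing
-- x_i by y would give a K_r in G.  For (iv), vertices of special degree ≥ 2 form
-- a clique by (iii), meet each part at most once by (ii), and are complete to X
-- outside their parts by (i); so two parts contain none of them, else adding a
-- suitable x_m gives a K_r, and an injectivity count bounds their number.

open import Defs hiding (sym)
open import Data.Nat using (ℕ; zero; suc; _≤_; _<_; _∸_; _≤?_; s≤s; z≤n)
open import Data.Nat.Properties using (≤-trans; <⇒≱; 1+n≰n)
open import Data.Fin using (Fin; _≟_; punchOut; fromℕ<) renaming (zero to fzero; suc to fsuc)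
open import Data.Fin.Properties using (any?; all?; ¬∀⟶∃¬; punchOut-injective; injective⇒≤)
open import Data.Bool using (Bool; true; false)
open import Data.Bool.Properties using (¬-not) renaming (_≟_ to _≟ᵇ_)
open import Data.List using (List; []; _∷_; length; filter; allFin; lookup)
open import Data.List.Relation.Unary.All using (_∷_)
import Data.List.Relation.Unary.All as All
open import Data.List.Relation.Unary.AllPairs using (_∷_)
open import Data.List.Relation.Unary.Any using (here; there)
open import Data.List.Relation.Unary.Unique.Propositional using (Unique)
open import Data.List.Relation.Unary.Unique.Propositional.Properties using (allFin⁺; filter⁺)
open import Data.List.Membership.Propositional using (_∈_)
open import Data.List.Membership.Propositional.Properties using (∈-lookup; ∈-filter⁻)
open import Data.Product using (_×_; Σ; ∃; ∃₂; _,_; proj₁; proj₂)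
open import Data.Sum using (_⊎_; inj₁; inj₂)
open import Function.Definitions using (Injective)
open import Relation.Nullary using (Dec; yes; no; ¬_; ¬?; contradiction)
open import Relation.Nullary.Decidable using (_×-dec_; _→-dec_)
open import Relation.Binary.PropositionalEquality
  using (_≡_; _≢_; refl; sym; trans; cong; subst₂; ≢-sym; module ≡-Reasoning)

skip : ∀ {m r} (f : Fin m → Fin (suc r)) {k} → (∀ t → f t ≢ k) → Fin m → Fin r
skip f misses t = punchOut (≢-sym (misses t))

skip-injective : ∀ {m r} (f : Fin m → Fin (suc r)) {k} (misses : ∀ t → f t ≢ k) →
  Injective _≡_ _≡_ f → Injective _≡_ _≡_ (skip f misses)
skip-injective f misses f-inj {t} {t′} e =
  f-inj (punchOut-injective (≢-sym (misses t)) (≢-sym (misses t′)) e)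

injective-missing⇒≤ : ∀ {m r} (f : Fin m → Fin (suc r)) {k} → Injective _≡_ _≡_ f →
  (∀ t → f t ≢ k) → m ≤ r
injective-missing⇒≤ f f-inj misses = injective⇒≤ (skip-injective f misses f-inj)

injective-missing-two⇒≤ : ∀ {m r} (f : Fin m → Fin r) {k l} → k ≢ l → Injective _≡_ _≡_ f →
  (∀ t → f t ≢ k) → (∀ t → f t ≢ l) → m ≤ r ∸ 2
injective-missing-two⇒≤ {r = suc zero} f {fzero} {fzero} k≢l _ _ _ = contradiction refl k≢l
injective-missing-two⇒≤ {r = suc (suc r)} f {k} {l} k≢l f-inj misses-k misses-l =
  injective-missing⇒≤ (skip f misses-k) (skip-injective f misses-k f-inj) skip-misses-l
  where
    skip-misses-l : ∀ t → skip f misses-k t ≢ punchOut k≢l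
    skip-misses-l t e = misses-l t (punchOut-injective (≢-sym (misses-k t)) k≢l e)

injective⇒surjective : ∀ {m} (f : Fin m → Fin m) → Injective _≡_ _≡_ f → ∀ k → ∃ λ i → f i ≡ k
injective⇒surjective {suc m} f f-inj k with any? (λ i → f i ≟ k)
... | yes hit = hit
... | no no-hit = contradiction (injective-missing⇒≤ f f-inj (λ t e → no-hit (t , e))) 1+n≰n

-- A map from a smaller Fin misses some value: otherwise choosing preimages
-- would inject Fin r into Fin m.
missed-value : ∀ {m r} → m < r → (f : Fin m → Fin r) → ∃ λ k → ∀ t → f t ≢ k
missed-value m<r f with any? (λ k → all? (λ t → ¬? (f t ≟ k)))
... | yes missed = missed
... | no ¬missed = contradiction (injective⇒≤ section-injective) (<⇒≱ m<r)
  where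
    preimage : ∀ k → ∃ λ t → f t ≡ k
    preimage k with any? (λ t → f t ≟ k)
    ... | yes hit = hit
    ... | no no-hit = contradiction (k , λ t e → no-hit (t , e)) ¬missed
    section-injective : Injective _≡_ _≡_ (λ k → proj₁ (preimage k))
    section-injective {k} {l} e = trans (sym (proj₂ (preimage k))) (trans (cong f e) (proj₂ (preimage l)))

index-avoiding-three : ∀ {r} → 4 ≤ r → (a b c : Fin r) → ∃ λ k → k ≢ a × k ≢ b × k ≢ c
index-avoiding-three {r} r≥4 a b c with missed-value r≥4 abc
  where
    abc : Fin 3 → Fin r
    abc fzero = a
    abc (fsuc fzero) = b
    abc (fsuc (fsuc fzero)) = c
... | k , misses = k , ≢-sym (misses fzero) , ≢-sym (misses (fsuc fzero)) , ≢-sym (misses (fsuc (fsuc fzero)))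

lookup-injective : ∀ {A : Set} {xs : List A} → Unique xs → Injective _≡_ _≡_ (lookup xs)
lookup-injective {xs = _ ∷ _} (_ ∷ _) {fzero} {fzero} _ = refl
lookup-injective {xs = _ ∷ xs} (fresh ∷ _) {fzero} {fsuc j} e =
  contradiction e (All.lookup fresh (∈-lookup {xs = xs} j))
lookup-injective {xs = _ ∷ xs} (fresh ∷ _) {fsuc i} {fzero} e =
  contradiction (sym e) (All.lookup fresh (∈-lookup {xs = xs} i))
lookup-injective {xs = _ ∷ _} (_ ∷ unique) {fsuc i} {fsuc j} e = cong fsuc (lookup-injective unique e)

two-distinct-members : ∀ {A : Set} {xs : List A} → Unique xs → 2 ≤ length xs →
  ∃₂ λ a b → a ≢ b × a ∈ xs × b ∈ xs
two-distinct-members {xs = a ∷ b ∷ _} ((a≢b ∷ _) ∷ _) _ = a , b , a≢b , here refl , there (here refl)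
two-distinct-members {xs = _ ∷ []} _ (s≤s ())

addEdge-edge : ∀ {n} (A : Fin n → Fin n → Bool) u v a b → addEdge A u v a b ≡ true →
  A a b ≡ true ⊎ (a ≡ u × b ≡ v) ⊎ (a ≡ v × b ≡ u)
addEdge-edge A u v a b h with A a b | a ≟ u | b ≟ v | a ≟ v | b ≟ u
... | true  | _     | _     | _     | _     = inj₁ refl
... | false | yes p | yes q | _     | _     = inj₂ (inj₁ (p , q))
... | false | _     | _     | yes p | yes q = inj₂ (inj₂ (p , q))
... | false | no _  | _     | no _  | _     = contradiction h λ ()
... | false | yes _ | no _  | no _  | _     = contradiction h λ ()
... | false | yes _ | no _  | yes _ | no _  = contradiction h λ ()
... | false | no _  | _     | yes _ | no _  = contradiction h λ ()

clique-uses-new-edge : ∀ {n r} (A : Fin n → Fin n → Bool) u v → ¬ HasKr r A →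
  (f : Fin r → Fin n) → (∀ i j → i ≢ j → f i ≢ f j) →
  (∀ i j → i ≢ j → addEdge A u v (f i) (f j) ≡ true) →
  (∃ λ i → f i ≡ u) × (∃ λ j → f j ≡ v)
clique-uses-new-edge A u v A-free f f-distinct f-adj
  with any? (λ i → any? (λ j → ¬? (i ≟ j) ×-dec (A (f i) (f j) ≟ᵇ false)))
... | no all-adjacent =
  contradiction (f , f-distinct , λ i j i≢j → ¬-not (λ e → all-adjacent (i , j , i≢j , e))) A-free
... | yes (i , j , i≢j , non-edge) with addEdge-edge A u v (f i) (f j) (f-adj i j i≢j)
...   | inj₁ edge = contradiction (trans (sym non-edge) edge) λ ()
...   | inj₂ (inj₁ (fi≡u , fj≡v)) = (i , fi≡u) , (j , fj≡v)
...   | inj₂ (inj₂ (fi≡v , fj≡u)) = (j , fj≡u) , (i , fi≡v)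

module _ {n r} (G : PartiteGraph n r) where

  adj-sym : ∀ {u v} → adj G u v ≡ true → adj G v u ≡ true
  adj-sym {u} {v} e = trans (sym (PartiteGraph.sym G u v)) e

  adj-cong : ∀ {a a′ b b′} → a ≡ a′ → b ≡ b′ → adj G a b ≡ true → adj G a′ b′ ≡ true
  adj-cong = subst₂ (λ a b → adj G a b ≡ true)

  addEdge-partite : ∀ {u v a b} → part G u ≢ part G v →
    addEdge (adj G) u v a b ≡ true → part G a ≢ part G b
  addEdge-partite {u} {v} {a} {b} parts-differ e with addEdge-edge (adj G) u v a b e
  ... | inj₁ edge = partite G a b edge
  ... | inj₂ (inj₁ (refl , refl)) = parts-differ
  ... | inj₂ (inj₂ (refl , refl)) = ≢-sym parts-differ

  cone⇒Kr : (m : Fin r) (w : Fin n) → part G w ≡ m →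
    (c : ∀ k → k ≢ m → Fin n) → (∀ k k≢m → part G (c k k≢m) ≡ k) →
    (∀ k l k≢m l≢m → k ≢ l → adj G (c k k≢m) (c l l≢m) ≡ true) →
    (∀ k k≢m → adj G w (c k k≢m) ≡ true) → HasKr r (adj G)
  cone⇒Kr m w w∈m c c-part c-adj w-adj = f , f-distinct , f-adj
    where
      vertexAt : ∀ k → Dec (k ≡ m) → Fin n
      vertexAt k (yes _) = w
      vertexAt k (no k≢m) = c k k≢m
      f : Fin r → Fin n
      f k = vertexAt k (k ≟ m)
      f-part : ∀ k → part G (f k) ≡ k
      f-part k with k ≟ m
      ... | yes refl = w∈m
      ... | no k≢m = c-part k k≢m
      f-distinct : ∀ k l → k ≢ l → f k ≢ f l
      f-distinct k l k≢l e = k≢l (trans (sym (f-part k)) (trans (cong (part G) e) (f-part l)))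
      f-adj : ∀ k l → k ≢ l → adj G (f k) (f l) ≡ true
      f-adj k l k≢l with k ≟ m | l ≟ m
      ... | yes refl | yes refl = contradiction refl k≢l
      ... | yes _    | no l≢m   = w-adj l l≢m
      ... | no k≢m   | yes _    = adj-sym (w-adj k k≢m)
      ... | no k≢m   | no l≢m   = c-adj k l k≢m l≢m k≢l

  record SaturatingClique (u v : Fin n) (a b : Fin r) : Set where
    field
      vertex      : Fin r → Fin n
      vertex-part : ∀ k → part G (vertex k) ≡ k
      vertex-a    : vertex a ≡ u
      vertex-b    : vertex b ≡ v
      vertex-adj  : ∀ k l → k ≢ l → addEdge (adj G) u v (vertex k) (vertex l) ≡ true
  open SaturatingClique public

  clique-position : ∀ {u v a b} (C : SaturatingClique u v a b) {i j w} →
    vertex C i ≡ w → vertex C j ≡ w → i ≡ j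
  clique-position C {i} {j} ei ej =
    trans (sym (vertex-part C i)) (trans (cong (part G) (trans ei (sym ej))) (vertex-part C j))

  clique-edge : ∀ {u v a b} (C : SaturatingClique u v a b) k l → k ≢ l →
    ¬ (k ≡ a × l ≡ b) → ¬ (k ≡ b × l ≡ a) → adj G (vertex C k) (vertex C l) ≡ true
  clique-edge {u} {v} {a} {b} C k l k≢l not-ab not-ba
    with addEdge-edge (adj G) u v (vertex C k) (vertex C l) (vertex-adj C k l k≢l)
  ... | inj₁ edge = edge
  ... | inj₂ (inj₁ (k≡u , l≡v)) =
    contradiction (clique-position C k≡u (vertex-a C) , clique-position C l≡v (vertex-b C)) not-ab
  ... | inj₂ (inj₂ (k≡v , l≡u)) =
    contradiction (clique-position C k≡v (vertex-b C) , clique-position C l≡u (vertex-a C)) not-ba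

  clique-edge-outside : ∀ {u v a b} (C : SaturatingClique u v a b) k l → k ≢ l → k ≢ a → k ≢ b →
    adj G (vertex C k) (vertex C l) ≡ true
  clique-edge-outside C k l k≢l k≢a k≢b = clique-edge C k l k≢l (λ p → k≢a (proj₁ p)) (λ p → k≢b (proj₁ p))

module Saturated {n r} (G : PartiteGraph n r) (sat : KrPartiteSaturated r G) where

  saturating-clique : ∀ {u v a b} → part G u ≡ a → part G v ≡ b → a ≢ b → adj G u v ≡ false →
    SaturatingClique G u v a b
  saturating-clique {u} {v} {a} {b} u∈a v∈b a≢b u≁v = record
    { vertex = vertex′ ; vertex-part = vertex′-part
    ; vertex-a = locate (proj₂ (proj₁ uses-uv)) u∈a
    ; vertex-b = locate (proj₂ (proj₂ uses-uv)) v∈b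
    ; vertex-adj = λ k l k≢l → f-adj (σ k) (σ l) (λ e → k≢l (σ-injective e)) }
    where
      parts-differ : part G u ≢ part G v
      parts-differ e = a≢b (trans (sym u∈a) (trans e v∈b))
      Kr : HasKr r (addEdge (adj G) u v)
      Kr = proj₂ sat u v (parts-differ , u≁v)
      f : Fin r → Fin n
      f = proj₁ Kr
      f-distinct : ∀ i j → i ≢ j → f i ≢ f j
      f-distinct = proj₁ (proj₂ Kr)
      f-adj : ∀ i j → i ≢ j → addEdge (adj G) u v (f i) (f j) ≡ true
      f-adj = proj₂ (proj₂ Kr)
      uses-uv : (∃ λ i → f i ≡ u) × (∃ λ j → f j ≡ v)
      uses-uv = clique-uses-new-edge (adj G) u v (proj₁ sat) f f-distinct f-adj
      parts-injective : Injective _≡_ _≡_ (λ i → part G (f i))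
      parts-injective {i} {j} e with i ≟ j
      ... | yes i≡j = i≡j
      ... | no i≢j = contradiction e (addEdge-partite G parts-differ (f-adj i j i≢j))
      -- σ k is the position of the K_r's vertex in V_k
      σ : Fin r → Fin r
      σ k = proj₁ (injective⇒surjective _ parts-injective k)
      vertex′ : Fin r → Fin n
      vertex′ k = f (σ k)
      vertex′-part : ∀ k → part G (vertex′ k) ≡ k
      vertex′-part k = proj₂ (injective⇒surjective _ parts-injective k)
      σ-injective : ∀ {k l} → σ k ≡ σ l → k ≡ l
      σ-injective {k} {l} e = trans (sym (vertex′-part k)) (trans (cong (λ i → part G (f i)) e) (vertex′-part l))
      locate : ∀ {w k i} → f i ≡ w → part G w ≡ k → vertex′ k ≡ w
      locate {w} {k} {i} e w∈k =
        trans (cong f (parts-injective (trans (vertex′-part k) (sym (trans (cong (part G) e) w∈k))))) e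

module Special {n r} (r≥4 : 4 ≤ r) (G : PartiteGraph n r) (sat : KrPartiteSaturated r G)
               (x : Fin r → Fin n) (ind : IndependentTransversal G x) where
  open Saturated G sat

  x-part : ∀ i → part G (x i) ≡ i
  x-part = proj₁ ind

  special-outside : ∀ {i y} → IsSpecialFor G x i y → part G y ≢ i
  special-outside {i} {y} (_ , xi~y , _) e = partite G (x i) y xi~y (trans (x-part i) (sym e))

  x-clique : ∀ {a b} → a ≢ b → SaturatingClique G (x a) (x b) a b
  x-clique {a} {b} a≢b = saturating-clique (x-part a) (x-part b) a≢b (proj₂ ind a b)

  -- If x_p sits at position p of a saturating clique C, then a p-special y whose
  -- part is not one of the two new-edge positions is the clique vertex of its
  -- part: that vertex is a neighbour of x_p in the part of y, and y is the only one.
  special-in-clique : ∀ {u v a b p y} (C : SaturatingClique G u v a b) → vertex C p ≡ x p →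
    IsSpecialFor G x p y → part G y ≢ a → part G y ≢ b → vertex C (part G y) ≡ y
  special-in-clique {p = p} {y} C Cp≡xp sp y∉a y∉b =
    proj₂ (proj₂ sp) (vertex C (part G y)) (vertex-part C (part G y))
      (adj-sym G (adj-cong G refl Cp≡xp (clique-edge-outside G C (part G y) p (special-outside sp) y∉a y∉b)))

  specials-adjacent-in-clique : ∀ {u v a b p q y y′} (C : SaturatingClique G u v a b) →
    vertex C p ≡ x p → vertex C q ≡ x q → IsSpecialFor G x p y → IsSpecialFor G x q y′ →
    part G y ≢ a → part G y ≢ b → part G y′ ≢ a → part G y′ ≢ b → part G y ≢ part G y′ →
    adj G y y′ ≡ true
  specials-adjacent-in-clique C Cp Cq sp sq y∉a y∉b y′∉a y′∉b y≢y′ =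
    adj-cong G (special-in-clique C Cp sp y∉a y∉b) (special-in-clique C Cq sq y′∉a y′∉b)
      (clique-edge-outside G C _ _ y≢y′ y∉a y∉b)

  special-adjacent-to-X : ∀ y → IsSpecial G x y → ∀ j → j ≢ part G y → adj G y (x j) ≡ true
  special-adjacent-to-X y (p , sp) j j∉y with j ≟ p
  ... | yes refl = adj-sym G (proj₁ (proj₂ sp))
  ... | no j≢p = adj-cong G (special-in-clique C (vertex-a C) sp (special-outside sp) (≢-sym j∉y)) (vertex-b C)
                   (clique-edge-outside G C (part G y) j (≢-sym j∉y) (special-outside sp) (≢-sym j∉y))
    where
      C : SaturatingClique G (x p) (x j) p j
      C = x-clique (≢-sym j≢p)

  special-unique-in-part : ∀ y y′ → IsSpecial G x y → IsSpecial G x y′ → part G y ≡ part G y′ → y ≡ y′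
  special-unique-in-part y y′ (p , sp) (q , sq) same with p ≟ q
  ... | yes refl = sym (proj₂ (proj₂ sp) y′ (sym same) (proj₁ (proj₂ sq)))
  ... | no p≢q = begin
    y                     ≡⟨ special-in-clique C (vertex-a C) sp (special-outside sp) y∉q ⟨
    vertex C (part G y)   ≡⟨ cong (vertex C) same ⟩
    vertex C (part G y′)  ≡⟨ special-in-clique C (vertex-b C) sq y′∉p (special-outside sq) ⟩
    y′                    ∎
    where
      open ≡-Reasoning
      C : SaturatingClique G (x p) (x q) p q
      C = x-clique p≢q
      y∉q : part G y ≢ q
      y∉q e = special-outside sq (trans (sym same) e)
      y′∉p : part G y′ ≢ p
      y′∉p e = special-outside sp (trans same e)

  specials-adjacent : ∀ y y′ p q → part G y ≢ part G y′ → IsSpecialFor G x p y → IsSpecialFor G x q y′ →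
    p ≢ part G y′ → q ≢ part G y → adj G y y′ ≡ true
  specials-adjacent y y′ p q y≢y′ sp sq p∉y′ q∉y with p ≟ q
  ... | no p≢q = specials-adjacent-in-clique C (vertex-a C) (vertex-b C)
        sp sq (special-outside sp) (≢-sym q∉y) (≢-sym p∉y′) (special-outside sq) y≢y′
    where
      C : SaturatingClique G (x p) (x q) p q
      C = x-clique p≢q
  ... | yes refl with index-avoiding-three r≥4 (part G y) (part G y′) p
  ... | k , k∉y , k∉y′ , k≢p = specials-adjacent-in-clique C (vertex-a C) (vertex-a C)
        sp sq (special-outside sp) (≢-sym k∉y) (special-outside sq) (≢-sym k∉y′) y≢y′
    where
      C : SaturatingClique G (x p) (x k) p k
      C = x-clique (≢-sym k≢p)

  -- (v) If y is p-special and y′ lies outside V_p and the part of y, then y′ is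
  -- adjacent to y or to x_p: when y′ x_p is a non-edge, y is the vertex of its
  -- part in the saturating clique of y′ x_p, hence adjacent to y′.
  special-or-x-neighbour : ∀ y p y′ → IsSpecialFor G x p y → part G y′ ≢ part G y → part G y′ ≢ p →
    adj G y′ y ≡ true ⊎ adj G y′ (x p) ≡ true
  special-or-x-neighbour y p y′ sp y′∉y y′∉p with adj G y′ (x p) in y′~xp
  ... | true = inj₂ refl
  ... | false = inj₁ (adj-sym G (adj-cong G y-in-C (vertex-a C)
                  (clique-edge-outside G C (part G y) (part G y′) (≢-sym y′∉y) (≢-sym y′∉y) (special-outside sp))))
    where
      C : SaturatingClique G y′ (x p) (part G y′) p
      C = saturating-clique refl (x-part p) y′∉p y′~xp
      y-in-C : vertex C (part G y) ≡ y
      y-in-C = special-in-clique C (vertex-b C) sp (≢-sym y′∉y) (special-outside sp)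

  NonNeighbourIn : Fin n → Fin r → Set
  NonNeighbourIn y k = Σ (Fin n) λ z → (part G z ≡ k) × (adj G (x (part G y)) z ≡ true) × (adj G y z ≡ false)

  -- For special y ∈ V_i and m ≠ i, the saturating clique C of x_i x_m has a vertex
  -- outside V_i ∪ V_m not adjacent to y; otherwise y is adjacent to all of C but
  -- x_i (to C_m = x_m by (i)), and replacing x_i by y gives a K_r in G.
  non-neighbour-in-clique : ∀ y → IsSpecial G x y → ∀ {m} → m ≢ part G y →
    (C : SaturatingClique G (x (part G y)) (x m) (part G y) m) →
    ∃ λ k → k ≢ part G y × k ≢ m × NonNeighbourIn y k
  non-neighbour-in-clique y special {m} m∉y C
    with any? (λ k → ¬? (k ≟ part G y) ×-dec ¬? (k ≟ m) ×-dec (adj G y (vertex C k) ≟ᵇ false))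
  ... | yes (k , k∉y , k≢m , y≁Ck) =
    k , k∉y , k≢m , vertex C k , vertex-part C k ,
    adj-sym G (adj-cong G refl (vertex-a C) (clique-edge-outside G C k (part G y) k∉y k∉y k≢m)) , y≁Ck
  ... | no none = contradiction
    (cone⇒Kr G (part G y) y refl (λ k _ → vertex C k) (λ k _ → vertex-part C k)
      (λ k l k∉y l∉y k≢l → clique-edge G C k l k≢l (λ p → k∉y (proj₁ p)) (λ p → l∉y (proj₂ p)))
      y-adj)
    (proj₁ sat)
    where
      y-adj : ∀ k → k ≢ part G y → adj G y (vertex C k) ≡ true
      y-adj k k∉y with k ≟ m
      ... | yes refl = adj-cong G refl (sym (vertex-b C)) (special-adjacent-to-X y special k k∉y)
      ... | no k≢m = ¬-not (λ y≁Ck → none (k , k∉y , k≢m , y≁Ck))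

  -- (vi) Applying the previous lemma first to x_p (y p-special) and then to the
  -- part just found gives two distinct parts with such non-neighbours.
  two-non-neighbour-parts : ∀ y → IsSpecial G x y →
    ∃₂ λ j l → part G y ≢ j × part G y ≢ l × j ≢ l × NonNeighbourIn y j × NonNeighbourIn y l
  two-non-neighbour-parts y special@(p , sp)
    with non-neighbour-in-clique y special (≢-sym (special-outside sp)) (x-clique (special-outside sp))
  ... | j , j∉y , _ , z with non-neighbour-in-clique y special j∉y (x-clique (≢-sym j∉y))
  ... | l , l∉y , l≢j , w = j , l , ≢-sym j∉y , ≢-sym l∉y , ≢-sym l≢j , z , w

  special? : ∀ y i → Dec (IsSpecialFor G x i y)
  special? y i = isSpecialFor? G x i y

  HighDegree : Fin n → Set
  HighDegree y = 2 ≤ specialDegree G x y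

  high-degree-two-indices : ∀ {y} → HighDegree y →
    ∃₂ λ a b → a ≢ b × IsSpecialFor G x a y × IsSpecialFor G x b y
  high-degree-two-indices {y} high with two-distinct-members (filter⁺ (special? y) (allFin⁺ r)) high
  ... | a , b , a≢b , a∈ , b∈ = a , b , a≢b , is-special a∈ , is-special b∈
    where
      is-special : ∀ {i} → i ∈ filter (special? y) (allFin r) → IsSpecialFor G x i y
      is-special i∈ = proj₂ (∈-filter⁻ (special? y) {xs = allFin r} i∈)

  high-degree-special : ∀ {y} → HighDegree y → IsSpecial G x y
  high-degree-special high with high-degree-two-indices high
  ... | a , _ , _ , sa , _ = a , sa

  special-avoiding : ∀ {y} → HighDegree y → ∀ m → ∃ λ p → IsSpecialFor G x p y × p ≢ m
  special-avoiding high m with high-degree-two-indices high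
  ... | a , b , a≢b , sa , sb with a ≟ m
  ...   | no a≢m = a , sa , a≢m
  ...   | yes refl = b , sb , ≢-sym a≢b

  high-degree-adjacent : ∀ {y y′} → HighDegree y → HighDegree y′ → part G y ≢ part G y′ → adj G y y′ ≡ true
  high-degree-adjacent {y} {y′} high high′ y≢y′
    with special-avoiding high (part G y′) | special-avoiding high′ (part G y)
  ... | p , sp , p∉y′ | q , sq , q∉y = specials-adjacent y y′ p q y≢y′ sp sq p∉y′ q∉y

  Occupied : Fin r → Set
  Occupied k = ∃ λ y → part G y ≡ k × HighDegree y

  occupied? : ∀ k → Dec (Occupied k)
  occupied? k = any? (λ y → (part G y ≟ k) ×-dec (2 ≤? specialDegree G x y))

  -- Not all parts other than V_m are occupied: the occupants form a clique
  -- complete to x_m by (i), and adding x_m would give a K_r in G.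
  not-all-occupied : ∀ m → ¬ (∀ k → k ≢ m → Occupied k)
  not-all-occupied m occupied = proj₁ sat
    (cone⇒Kr G m (x m) (x-part m) occupant occupant-part
      (λ k l k≢m l≢m k≢l → high-degree-adjacent (occupant-high k k≢m) (occupant-high l l≢m)
         (λ e → k≢l (trans (sym (occupant-part k k≢m)) (trans e (occupant-part l l≢m)))))
      (λ k k≢m → adj-sym G (special-adjacent-to-X _ (high-degree-special (occupant-high k k≢m)) m
         (λ e → k≢m (trans (sym (occupant-part k k≢m)) (sym e))))))
    where
      occupant : ∀ k → k ≢ m → Fin n
      occupant k k≢m = proj₁ (occupied k k≢m)
      occupant-part : ∀ k k≢m → part G (occupant k k≢m) ≡ k
      occupant-part k k≢m = proj₁ (proj₂ (occupied k k≢m))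
      occupant-high : ∀ k k≢m → HighDegree (occupant k k≢m)
      occupant-high k k≢m = proj₂ (proj₂ (occupied k k≢m))

  unoccupied-besides : ∀ m → ∃ λ k → k ≢ m × ¬ Occupied k
  unoccupied-besides m =
    let k , ¬implication = ¬∀⟶∃¬ r (λ k → k ≢ m → Occupied k) (λ k → ¬? (k ≟ m) →-dec occupied? k)
                                  (not-all-occupied m)
    in k , (λ k≡m → ¬implication (λ k≢m → contradiction k≡m k≢m)) , (λ occ → ¬implication (λ _ → occ))

  -- By (ii) the parts of the high-degree vertices are distinct; if two parts are
  -- unoccupied, there are at most r ∸ 2 of them.
  high-degree-count : ∀ {k l} → k ≢ l → ¬ Occupied k → ¬ Occupied l → numSpecialDeg≥2 G x ≤ r ∸ 2
  high-degree-count k≢l unoccupied-k unoccupied-l =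
    injective-missing-two⇒≤ partOf k≢l partOf-injective (avoids unoccupied-k) (avoids unoccupied-l)
    where
      high? : ∀ y → Dec (HighDegree y)
      high? y = 2 ≤? specialDegree G x y
      H : List (Fin n)
      H = filter high? (allFin n)
      H-high : ∀ t → HighDegree (lookup H t)
      H-high t = proj₂ (∈-filter⁻ high? {xs = allFin n} (∈-lookup {xs = H} t))
      partOf : Fin (length H) → Fin r
      partOf t = part G (lookup H t)
      partOf-injective : Injective _≡_ _≡_ partOf
      partOf-injective {t} {t′} e = lookup-injective (filter⁺ high? (allFin⁺ n))
        (special-unique-in-part _ _ (high-degree-special (H-high t)) (high-degree-special (H-high t′)) e)
      avoids : ∀ {k} → ¬ Occupied k → ∀ t → partOf t ≢ k
      avoids unoccupied t e = unoccupied (lookup H t , e , H-high t)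

  few-high-degree : numSpecialDeg≥2 G x ≤ r ∸ 2
  few-high-degree =
    let k , _ , unoccupied-k = unoccupied-besides index₀
        l , l≢k , unoccupied-l = unoccupied-besides k
    in high-degree-count (≢-sym l≢k) unoccupied-k unoccupied-l
    where
      index₀ : Fin r
      index₀ = fromℕ< (≤-trans (s≤s z≤n) r≥4)

lemma5p1 : ∀ {n} (r : ℕ) → 4 ≤ r → (G : PartiteGraph n r) → KrPartiteSaturated r G →
    (x : Fin r → Fin n) → IndependentTransversal G x →
    -- (i)
    (∀ y → IsSpecial G x y → ∀ j → j ≢ part G y → adj G y (x j) ≡ true)
    -- (ii)
    × (∀ y y′ → IsSpecial G x y → IsSpecial G x y′ → part G y ≡ part G y′ → y ≡ y′)
    -- (iii)
    × (∀ y y′ i′ j′ → part G y ≢ part G y′ → IsSpecialFor G x i′ y → IsSpecialFor G x j′ y′ →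
         i′ ≢ part G y′ → j′ ≢ part G y → adj G y y′ ≡ true)
    -- (iv)
    × (numSpecialDeg≥2 G x ≤ r ∸ 2)
    -- (v)
    × (∀ y i′ y′ → IsSpecialFor G x i′ y → part G y′ ≢ part G y → part G y′ ≢ i′ →
         (adj G y′ y ≡ true) ⊎ (adj G y′ (x i′) ≡ true))
    -- (vi)
    × (∀ y → IsSpecial G x y →
         Σ (Fin r) λ j → Σ (Fin r) λ l →
           (part G y ≢ j) × (part G y ≢ l) × (j ≢ l) ×
           (Σ (Fin n) λ z → (part G z ≡ j) × (adj G (x (part G y)) z ≡ true) × (adj G y z ≡ false)) ×
           (Σ (Fin n) λ w → (part G w ≡ l) × (adj G (x (part G y)) w ≡ true) × (adj G y w ≡ false)))
lemma5p1 r r≥4 G sat x ind =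
  special-adjacent-to-X , special-unique-in-part , specials-adjacent , few-high-degree ,
  special-or-x-neighbour , two-non-neighbour-parts
  where
    open Special r≥4 G sat x ind
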